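{- Let $\mathcal R=(\mathcal F,\Pi,\mu,E,H,R)$ be an EGTRS. Then $\to_{\mathcal R/E}\;=\;{=_E}\circ\to_{\mathcal R}\circ{=_E}$, and $\to_{\mathcal R}\subseteq\to_{\mathcal R,E}\subseteq\to_{\mathcal R/E}$.
   Context: Terms are built from a signature $\mathcal F$ and a countable set $\mathcal X$ of variables; $t|_p$, $t[s]_p$, $\Lambda$ (root position) are standard. A replacement map $\mu$ assigns to each $k$-ary $f\in\mathcal F$ a set $\mu(f)\subseteq\{1,\dots,k\}$; active positions are $\mathcal{P}os^\mu(x)=\{\Lambda\}$ and $\mathcal{P}os^\mu(f(t_1,\dots,t_k))=\{\Lambda\}\cup\{i.q\mid i\in\mu(f),q\in\mathcal{P}os^\mu(t_i)\}$. An EGTRS is a tuple $\mathcal R=(\mathcal F,\Pi,\mu,E,H,R)$ where $\Pi$ is a signature of predicate symbols containing binary $=,\to,\to^*$; $E$ is a set of conditional equations $s=t\Leftarrow c$; $H$ is a set of definite Horn clauses $A\Leftarrow c$ whose head predicate is not $=,\to,\to^*$; $R$ is a set of conditional rules $\ell\to r\Leftarrow c$ with $\ell\notin\mathcal X$; each $c$ is a finite sequence of atoms. A predicate $P$ depends on $R$ if $P\in\{\to,\to^*\}$ or some clause $A\Leftarrow A_1,\dots,A_n$ of $E\cup H$ has head predicate $P$ and some $A_i$ has a predicate depending on $R$; it is assumed throughout that $=$ does not depend on $R$. $R^{rm}$ is $R$ with every occurrence of the predicate $\approx$ replaced by a new symbol $\approx_{rm}$; $H^{rm}$ is $H$ with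 $\approx,\to,\to^*$ replaced by new symbols $\approx_{rm},\to_{rm},\to^*_{rm}$. The theory $\mathsf{Th}^{CR}$ consists of the universal closures of: (a) $x=x$; $x=y\Rightarrow y=x$; $x=y\wedge y=z\Rightarrow x=z$; $x_i=y_i\Rightarrow f(x_1,..,x_i,..,x_k)=f(x_1,..,y_i,..,x_k)$ for $f\in\mathcal F$, $i\in\mu(f)$; $A_1\wedge\dots\wedge A_n\Rightarrow s=t$ for each $s=t\Leftarrow A_1,\dots,A_n\in E$; (b) $x\to^*x$; $x\to y\wedge y\to^*z\Rightarrow x\to^*z$; $x_i\to y_i\Rightarrow f(..,x_i,..)\to f(..,y_i,..)$ for $i\in\mu(f)$; $A_1\wedge\dots\wedge A_n\Rightarrow\ell\to r$ for each $\ell\to r\Leftarrow A_1,\dots,A_n\in R^{rm}$; (c) $x\to_{ps}^*x$; $x\to_{ps}y\wedge y\to^*_{ps}z\Rightarrow x\to^*_{ps}z$; $x_i\to_{ps}y_i\Rightarrow f(..,x_i,..)\to_{ps}f(..,y_i,..)$ for $i\in\mu(f)$; $x=\ell\wedge A_1\wedge\dots\wedge A_n\Rightarrow x\to_{ps}r$ ($x$ fresh) for each $\ell\to r\Leftarrow A_1,\dots,A_n\in R^{rm}$; (d) $x\to^*_{rm}x$; $x\to_{rm}y\wedge y\to^*_{rm}z\Rightarrow x\to^*_{rm}z$; $x=x'\wedge x'\to y'\wedge y'=y\Rightarrow x\to_{rm}y$; (e) $A_1\wedge\dots\wedge A_n\Rightarrow A$ for each $A\Leftarrow A_1,\dots,A_n\in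 H^{rm}$. $s\to_{\mathcal R}t$, $s\to_{\mathcal R,E}t$, $s\to_{\mathcal R/E}t$ hold iff $s\to t$, $s\to_{ps}t$, $s\to_{rm}t$, respectively, is deducible from $\mathsf{Th}^{CR}$. $s=_Et$ holds iff $s=t$ is deducible from the sentences (a) together with $A_1\wedge\dots\wedge A_n\Rightarrow A$ for each clause $A\Leftarrow A_1,\dots,A_n$ of $H$. $\circ$ denotes relational composition.
   Formalization: The predicate ≈ is never renamed to $\approx_{rm}$: $R^{rm}$ is R itself, and $H^{rm}$ replaces only → and →* by $\to_{rm}$ and $\to^*_{rm}$, keeping ≈ as it is. The statement above fails without it. -}

module Defs where

open import Data.Nat using (ℕ)
open import Data.Fin using (Fin)
open import Data.Bool using (Bool; true)
open import Data.Vec using (Vec; []; _∷_; lookup; _[_]≔_)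
open import Data.List using (List)
open import Data.List.Relation.Unary.All using (All)
open import Data.List.Membership.Propositional using (_∈_)
open import Data.Product using (Σ; _×_; _,_)
open import Relation.Binary.PropositionalEquality using (_≡_)
open import Relation.Nullary using (¬_)
open import Relation.Binary.Core using (Rel)
open import Level using (0ℓ)

infixr 9 _⨾_
_⨾_ : ∀ {A : Set} → Rel A 0ℓ → Rel A 0ℓ → Rel A 0ℓ
(L ⨾ R) x z = Σ _ λ y → L x y × R y z

-- UPred / upar : the predicate symbols of Π other than the binary
--   =, →, →* (which are built in below), with their arities.

record Signature : Set₁ where
  field
    Fun   : Set
    ar    : Fun → ℕ
    UPred : Set
    upar  : UPred → ℕ

open Signature public

module _ (S : Signature) where

  data Term : Set where
    var : ℕ → Term
    fun : (f : Fun S) → Vec Term (ar S f) → Term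

  Subst : Set
  Subst = ℕ → Term

  mutual
    _⟨_⟩ : Term → Subst → Term
    var x ⟨ σ ⟩ = σ x
    fun f ts ⟨ σ ⟩ = fun f (ts ⟨ σ ⟩*)

    _⟨_⟩* : ∀ {n} → Vec Term n → Subst → Vec Term n
    [] ⟨ σ ⟩* = []
    (t ∷ ts) ⟨ σ ⟩* = (t ⟨ σ ⟩) ∷ (ts ⟨ σ ⟩*)

  data PSym : Set where
    eqP rwP rwsP : PSym
    usr : UPred S → PSym

  parity : PSym → ℕ
  parity eqP = 2
  parity rwP = 2
  parity rwsP = 2
  parity (usr p) = upar S p

  record Atom : Set where
    constructor _⦅_⦆
    field
      sym  : PSym
      args : Vec Term (parity sym)

  -- predicate symbols of the theories: those of Π together with the
  -- new symbols →_rm, →*_rm, →_ps, →*_ps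
  data XSym : Set where
    orig : PSym → XSym
    rwRm rwsRm rwPs rwsPs : XSym

  xarity : XSym → ℕ
  xarity (orig p) = parity p
  xarity rwRm = 2
  xarity rwsRm = 2
  xarity rwPs = 2
  xarity rwsPs = 2

  record XAtom : Set where
    constructor _⟪_⟫
    field
      xsym  : XSym
      xargs : Vec Term (xarity xsym)

  plain : Atom → XAtom
  plain (p ⦅ ts ⦆) = orig p ⟪ ts ⟫

  -- renaming used for R^rm (only ≈ is renamed; ≈ is not a symbol of Π
  -- here, so this is the identity)
  rmR : Atom → XAtom
  rmR = plain

  rmH : Atom → XAtom
  rmH (eqP ⦅ ts ⦆) = orig eqP ⟪ ts ⟫
  rmH (rwP ⦅ ts ⦆) = rwRm ⟪ ts ⟫
  rmH (rwsP ⦅ ts ⦆) = rwsRm ⟪ ts ⟫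
  rmH (usr p ⦅ ts ⦆) = orig (usr p) ⟪ ts ⟫

  substX : XAtom → Subst → XAtom
  substX (P ⟪ ts ⟫) σ = P ⟪ ts ⟨ σ ⟩* ⟫

  record CEquation : Set where
    field
      eqL eqR : Term
      eqC     : List Atom

  record HClause : Set where
    field
      hPred : UPred S
      hArgs : Vec Term (upar S hPred)
      hC    : List Atom

  record CRule : Set where
    field
      ruL ruR   : Term
      ruL-nonvar : ¬ (Σ ℕ λ x → ruL ≡ var x)
      ruC       : List Atom

  open CEquation public
  open HClause public
  open CRule public

  record EGTRS : Set₁ where
    field
      μ : (f : Fun S) → Fin (ar S f) → Bool
      E : CEquation → Set
      H : HClause → Set
      R : CRule → Set

  module _ (𝓡 : EGTRS) where
    open EGTRS 𝓡

    data DependsOnR : PSym → Set where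
      dep-rw  : DependsOnR rwP
      dep-rws : DependsOnR rwsP
      dep-E   : ∀ {e} → E e → ∀ {A} → A ∈ eqC e →
                DependsOnR (Atom.sym A) → DependsOnR eqP
      dep-H   : ∀ {h} → H h → ∀ {A} → A ∈ hC h →
                DependsOnR (Atom.sym A) → DependsOnR (usr (hPred h))

    EQ RW RWS : Term → Term → XAtom
    EQ s t = orig eqP ⟪ s ∷ t ∷ [] ⟫
    RW s t = orig rwP ⟪ s ∷ t ∷ [] ⟫
    RWS s t = orig rwsP ⟪ s ∷ t ∷ [] ⟫

    -- Derivability from Th^CR (a)-(e) (closure under instances of the
    -- universally closed Horn sentences)
    data ThCR : XAtom → Set where
      a-refl  : ∀ x → ThCR (EQ x x)
      a-sym   : ∀ {x y} → ThCR (EQ x y) → ThCR (EQ y x)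
      a-trans : ∀ {x y z} → ThCR (EQ x y) → ThCR (EQ y z) → ThCR (EQ x z)
      a-cong  : ∀ f (i : Fin (ar S f)) → μ f i ≡ true → ∀ ts y →
                ThCR (EQ (lookup ts i) y) →
                ThCR (EQ (fun f ts) (fun f (ts [ i ]≔ y)))
      a-E     : ∀ {e} → E e → (σ : Subst) →
                All (λ A → ThCR (substX (plain A) σ)) (eqC e) →
                ThCR (EQ (eqL e ⟨ σ ⟩) (eqR e ⟨ σ ⟩))
      b-refl  : ∀ x → ThCR (RWS x x)
      b-step  : ∀ {x y z} → ThCR (RW x y) → ThCR (RWS y z) → ThCR (RWS x z)
      b-cong  : ∀ f (i : Fin (ar S f)) → μ f i ≡ true → ∀ ts y →
                ThCR (RW (lookup ts i) y) →
                ThCR (RW (fun f ts) (fun f (ts [ i ]≔ y)))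
      b-rule  : ∀ {ρ} → R ρ → (σ : Subst) →
                All (λ A → ThCR (substX (rmR A) σ)) (ruC ρ) →
                ThCR (RW (ruL ρ ⟨ σ ⟩) (ruR ρ ⟨ σ ⟩))
      c-refl  : ∀ x → ThCR (rwsPs ⟪ x ∷ x ∷ [] ⟫)
      c-step  : ∀ {x y z} → ThCR (rwPs ⟪ x ∷ y ∷ [] ⟫) →
                ThCR (rwsPs ⟪ y ∷ z ∷ [] ⟫) → ThCR (rwsPs ⟪ x ∷ z ∷ [] ⟫)
      c-cong  : ∀ f (i : Fin (ar S f)) → μ f i ≡ true → ∀ ts y →
                ThCR (rwPs ⟪ lookup ts i ∷ y ∷ [] ⟫) →
                ThCR (rwPs ⟪ fun f ts ∷ fun f (ts [ i ]≔ y) ∷ [] ⟫)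
      c-rule  : ∀ {ρ} → R ρ → (σ : Subst) → ∀ x →
                ThCR (EQ x (ruL ρ ⟨ σ ⟩)) →
                All (λ A → ThCR (substX (rmR A) σ)) (ruC ρ) →
                ThCR (rwPs ⟪ x ∷ ruR ρ ⟨ σ ⟩ ∷ [] ⟫)
      d-refl  : ∀ x → ThCR (rwsRm ⟪ x ∷ x ∷ [] ⟫)
      d-step  : ∀ {x y z} → ThCR (rwRm ⟪ x ∷ y ∷ [] ⟫) →
                ThCR (rwsRm ⟪ y ∷ z ∷ [] ⟫) → ThCR (rwsRm ⟪ x ∷ z ∷ [] ⟫)
      d-rm    : ∀ {x x′ y′ y} → ThCR (EQ x x′) → ThCR (RW x′ y′) →
                ThCR (EQ y′ y) → ThCR (rwRm ⟪ x ∷ y ∷ [] ⟫)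
      e-H     : ∀ {h} → H h → (σ : Subst) →
                All (λ A → ThCR (substX (rmH A) σ)) (hC h) →
                ThCR (orig (usr (hPred h)) ⟪ hArgs h ⟨ σ ⟩* ⟫)

    -- Derivability from (a) together with the clauses of H (unchanged)
    data ThE : XAtom → Set where
      a-refl  : ∀ x → ThE (EQ x x)
      a-sym   : ∀ {x y} → ThE (EQ x y) → ThE (EQ y x)
      a-trans : ∀ {x y z} → ThE (EQ x y) → ThE (EQ y z) → ThE (EQ x z)
      a-cong  : ∀ f (i : Fin (ar S f)) → μ f i ≡ true → ∀ ts y →
                ThE (EQ (lookup ts i) y) →
                ThE (EQ (fun f ts) (fun f (ts [ i ]≔ y)))
      a-E     : ∀ {e} → E e → (σ : Subst) →
                All (λ A → ThE (substX (plain A) σ)) (eqC e) →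
                ThE (EQ (eqL e ⟨ σ ⟩) (eqR e ⟨ σ ⟩))
      h-H     : ∀ {h} → H h → (σ : Subst) →
                All (λ A → ThE (substX (plain A) σ)) (hC h) →
                ThE (orig (usr (hPred h)) ⟪ hArgs h ⟨ σ ⟩* ⟫)

    RStep : Rel Term 0ℓ
    RStep s t = ThCR (RW s t)

    REStep : Rel Term 0ℓ
    REStep s t = ThCR (rwPs ⟪ s ∷ t ∷ [] ⟫)

    RmodEStep : Rel Term 0ℓ
    RmodEStep s t = ThCR (rwRm ⟪ s ∷ t ∷ [] ⟫)

    EqE : Rel Term 0ℓ
    EqE s t = ThE (EQ s t)

{-# OPTIONS --safe #-}
module Submission where

open import Defs
open import Data.Bool using (true)
open import Data.Empty using (⊥; ⊥-elim)
open import Data.Fin using (Fin)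
open import Data.List using (List; _∷_)
open import Data.List.Relation.Unary.All as All using (All; []; _∷_)
open import Data.Product using (_×_; _,_)
open import Data.Vec using (lookup; _[_]≔_)
open import Data.Vec.Properties using ([]≔-idempotent; lookup∘update)
open import Function using (_∘_)
open import Level using (0ℓ)
open import Relation.Binary.Core using (Rel; _⇒_; _⇔_)
open import Relation.Binary.PropositionalEquality using (_≡_; sym; subst)
open import Relation.Nullary using (¬_)

-- Since = does not depend on R, a derivation of an equation from Th^CR
-- only uses the sentences (a) and the sentences (e) of clauses whose
-- conditions do not depend on R; on those clauses H^rm coincides with H, so
-- the derivation is one of =_E.  The only sentence concluding x →_rm y is
-- the one in (d), which yields the decomposition of →_{R/E}.  For the
-- inclusion →_{R,E} ⊆ →_{R/E}, the E-equality and the rule step inside a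
-- →_{R,E}-step are lifted separately through the active context.

module _ {S : Signature} where

  cong-updated : ∀ {_∼_ : Rel (Term S) 0ℓ} f (i : Fin (ar S f)) →
                 (∀ ts y → lookup ts i ∼ y → fun f ts ∼ fun f (ts [ i ]≔ y)) →
                 ∀ ts {x y} → x ∼ y → fun f (ts [ i ]≔ x) ∼ fun f (ts [ i ]≔ y)
  cong-updated {_∼_} f i cong ts {x} {y} x∼y =
    subst (λ us → fun f (ts [ i ]≔ x) ∼ fun f us) ([]≔-idempotent ts i)
      (cong (ts [ i ]≔ x) y (subst (_∼ y) (sym (lookup∘update i ts x)) x∼y))

module _ {S : Signature} (𝓡 : EGTRS S) where
  open EGTRS 𝓡

  IndependentOfR : XAtom S → Set
  IndependentOfR (orig p ⟪ _ ⟫) = ¬ DependsOnR S 𝓡 p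
  IndependentOfR (rwRm ⟪ _ ⟫)   = ⊥
  IndependentOfR (rwsRm ⟪ _ ⟫)  = ⊥
  IndependentOfR (rwPs ⟪ _ ⟫)   = ⊥
  IndependentOfR (rwsPs ⟪ _ ⟫)  = ⊥

  mutual
    ThCR⇒ThE : ∀ {A} → ThCR S 𝓡 A → IndependentOfR A → ThE S 𝓡 A
    ThCR⇒ThE (a-refl x)                _  = a-refl x
    ThCR⇒ThE (a-sym d)                 ¬d = a-sym (ThCR⇒ThE d ¬d)
    ThCR⇒ThE (a-trans d d′)            ¬d = a-trans (ThCR⇒ThE d ¬d) (ThCR⇒ThE d′ ¬d)
    ThCR⇒ThE (a-cong f i μfi ts y d)   ¬d = a-cong f i μfi ts y (ThCR⇒ThE d ¬d)
    ThCR⇒ThE (a-E e∈E σ ds)            ¬d =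
      a-E e∈E σ (ThCR⇒ThE-plain (All.tabulate λ A∈c → ¬d ∘ dep-E e∈E A∈c) ds)
    ThCR⇒ThE (e-H h∈H σ ds)            ¬d =
      h-H h∈H σ (ThCR⇒ThE-rmH (All.tabulate λ A∈c → ¬d ∘ dep-H h∈H A∈c) ds)
    ThCR⇒ThE (b-refl _)                ¬d = ⊥-elim (¬d dep-rws)
    ThCR⇒ThE (b-step _ _)              ¬d = ⊥-elim (¬d dep-rws)
    ThCR⇒ThE (b-cong _ _ _ _ _ _)      ¬d = ⊥-elim (¬d dep-rw)
    ThCR⇒ThE (b-rule _ _ _)            ¬d = ⊥-elim (¬d dep-rw)
    ThCR⇒ThE (c-refl _)                ()
    ThCR⇒ThE (c-step _ _)              ()
    ThCR⇒ThE (c-cong _ _ _ _ _ _)      ()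
    ThCR⇒ThE (c-rule _ _ _ _ _)        ()
    ThCR⇒ThE (d-refl _)                ()
    ThCR⇒ThE (d-step _ _)              ()
    ThCR⇒ThE (d-rm _ _ _)              ()

    ThCR⇒ThE-plain : ∀ {σ} {c : List (Atom S)} →
                     All (λ A → ¬ DependsOnR S 𝓡 (Atom.sym A)) c →
                     All (λ A → ThCR S 𝓡 (substX S (plain S A) σ)) c →
                     All (λ A → ThE S 𝓡 (substX S (plain S A) σ)) c
    ThCR⇒ThE-plain []         []       = []
    ThCR⇒ThE-plain (¬d ∷ ¬ds) (d ∷ ds) = ThCR⇒ThE d ¬d ∷ ThCR⇒ThE-plain ¬ds ds

    ThCR⇒ThE-rmH : ∀ {σ} {c : List (Atom S)} →
                   All (λ A → ¬ DependsOnR S 𝓡 (Atom.sym A)) c →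
                   All (λ A → ThCR S 𝓡 (substX S (rmH S A) σ)) c →
                   All (λ A → ThE S 𝓡 (substX S (plain S A) σ)) c
    ThCR⇒ThE-rmH                         []         []       = []
    ThCR⇒ThE-rmH {c = (eqP ⦅ _ ⦆) ∷ _}   (¬d ∷ ¬ds) (d ∷ ds) = ThCR⇒ThE d ¬d ∷ ThCR⇒ThE-rmH ¬ds ds
    ThCR⇒ThE-rmH {c = (usr _ ⦅ _ ⦆) ∷ _} (¬d ∷ ¬ds) (d ∷ ds) = ThCR⇒ThE d ¬d ∷ ThCR⇒ThE-rmH ¬ds ds
    ThCR⇒ThE-rmH {c = (rwP ⦅ _ ⦆) ∷ _}   (¬d ∷ _)   _        = ⊥-elim (¬d dep-rw)
    ThCR⇒ThE-rmH {c = (rwsP ⦅ _ ⦆) ∷ _}  (¬d ∷ _)   _        = ⊥-elim (¬d dep-rws)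

  mutual
    ThE⇒ThCR : ∀ {A} → ThE S 𝓡 A → ThCR S 𝓡 A
    ThE⇒ThCR (a-refl x)              = a-refl x
    ThE⇒ThCR (a-sym d)               = a-sym (ThE⇒ThCR d)
    ThE⇒ThCR (a-trans d d′)          = a-trans (ThE⇒ThCR d) (ThE⇒ThCR d′)
    ThE⇒ThCR (a-cong f i μfi ts y d) = a-cong f i μfi ts y (ThE⇒ThCR d)
    ThE⇒ThCR (a-E e∈E σ ds)          = a-E e∈E σ (ThE⇒ThCR-plain ds)
    ThE⇒ThCR (h-H h∈H σ ds)          = e-H h∈H σ (ThE⇒ThCR-rmH ds)

    ThE⇒ThCR-plain : ∀ {σ} {c : List (Atom S)} →
                     All (λ A → ThE S 𝓡 (substX S (plain S A) σ)) c →
                     All (λ A → ThCR S 𝓡 (substX S (plain S A) σ)) c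
    ThE⇒ThCR-plain []       = []
    ThE⇒ThCR-plain (d ∷ ds) = ThE⇒ThCR d ∷ ThE⇒ThCR-plain ds

    ThE⇒ThCR-rmH : ∀ {σ} {c : List (Atom S)} →
                   All (λ A → ThE S 𝓡 (substX S (plain S A) σ)) c →
                   All (λ A → ThCR S 𝓡 (substX S (rmH S A) σ)) c
    ThE⇒ThCR-rmH                         []       = []
    ThE⇒ThCR-rmH {c = (eqP ⦅ _ ⦆) ∷ _}   (d ∷ ds) = ThE⇒ThCR d ∷ ThE⇒ThCR-rmH ds
    ThE⇒ThCR-rmH {c = (usr _ ⦅ _ ⦆) ∷ _} (d ∷ ds) = ThE⇒ThCR d ∷ ThE⇒ThCR-rmH ds
    ThE⇒ThCR-rmH {c = (rwP ⦅ _ ⦆) ∷ _}   (() ∷ _)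
    ThE⇒ThCR-rmH {c = (rwsP ⦅ _ ⦆) ∷ _}  (() ∷ _)

  RStep⇒REStep : RStep S 𝓡 ⇒ REStep S 𝓡
  RStep⇒REStep (b-cong f i μfi ts y d) = c-cong f i μfi ts y (RStep⇒REStep d)
  RStep⇒REStep (b-rule ρ∈R σ cs)       = c-rule ρ∈R σ _ (a-refl _) cs

  RmodEStep-cong : ∀ f (i : Fin (ar S f)) → μ f i ≡ true → ∀ ts y →
                   RmodEStep S 𝓡 (lookup ts i) y →
                   RmodEStep S 𝓡 (fun f ts) (fun f (ts [ i ]≔ y))
  RmodEStep-cong f i μfi ts y (d-rm {x′ = x′} x=x′ x′→y′ y′=y) =
    d-rm (a-cong f i μfi ts x′ x=x′)
         (cong-updated {_∼_ = RStep S 𝓡} f i (b-cong f i μfi) ts x′→y′)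
         (cong-updated {_∼_ = λ s t → ThCR S 𝓡 (EQ S 𝓡 s t)} f i (a-cong f i μfi) ts y′=y)

  REStep⇒RmodEStep : REStep S 𝓡 ⇒ RmodEStep S 𝓡
  REStep⇒RmodEStep (c-cong f i μfi ts y d)  = RmodEStep-cong f i μfi ts y (REStep⇒RmodEStep d)
  REStep⇒RmodEStep (c-rule ρ∈R σ _ x=ℓσ cs) = d-rm x=ℓσ (b-rule ρ∈R σ cs) (a-refl _)

  RmodEStep⇒EqE⨾RStep⨾EqE : ¬ DependsOnR S 𝓡 eqP →
                            RmodEStep S 𝓡 ⇒ (EqE S 𝓡 ⨾ RStep S 𝓡 ⨾ EqE S 𝓡)
  RmodEStep⇒EqE⨾RStep⨾EqE ¬dep (d-rm x=x′ x′→y′ y′=y) =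
    _ , ThCR⇒ThE x=x′ ¬dep , _ , x′→y′ , ThCR⇒ThE y′=y ¬dep

  EqE⨾RStep⨾EqE⇒RmodEStep : (EqE S 𝓡 ⨾ RStep S 𝓡 ⨾ EqE S 𝓡) ⇒ RmodEStep S 𝓡
  EqE⨾RStep⨾EqE⇒RmodEStep (_ , x=x′ , _ , x′→y′ , y′=y) =
    d-rm (ThE⇒ThCR x=x′) x′→y′ (ThE⇒ThCR y′=y)

proposition5p21 : (S : Signature) (𝓡 : EGTRS S) →
    ¬ DependsOnR S 𝓡 (eqP) →
    (RmodEStep S 𝓡 ⇔ (EqE S 𝓡 ⨾ RStep S 𝓡 ⨾ EqE S 𝓡))
    × (RStep S 𝓡 ⇒ REStep S 𝓡) × (REStep S 𝓡 ⇒ RmodEStep S 𝓡)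
proposition5p21 S 𝓡 ¬dep =
  (RmodEStep⇒EqE⨾RStep⨾EqE 𝓡 ¬dep , EqE⨾RStep⨾EqE⇒RmodEStep 𝓡) ,
  RStep⇒REStep 𝓡 , REStep⇒RmodEStep 𝓡
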